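{- Consider the Vanilla algorithm run on an undirected graph $G$, and let $u$ be any vertex. For every integer $k \ge 0$, after $k$ phases of the Vanilla algorithm, $u$ is ongoing with probability at most $(3/4)^k$.
   Context: Let $G$ be an undirected graph on $n$ vertices. Every vertex $v$ has a parent $v.p$, initially $v.p = v$; $v$ is a root iff $v.p = v$. The algorithm maintains a multiset of current edges, initially the edges of $G$; each edge $\{v,w\}$ is viewed as two arcs $(v,w)$ and $(w,v)$. The Vanilla algorithm repeats the following phase until no current edge other than loops exists: (1) random-vote: every vertex $u$ independently sets $u.l := 1$ with probability $1/2$ and $u.l := 0$ otherwise; (2) link: for every current arc $(v,w)$, if $v.l = 0$ and $w.l = 1$ then set $v.p := w$ (concurrent writes resolved arbitrarily); (3) shortcut: every vertex $u$ simultaneously sets $u.p := u.p.p$; (4) alter: every current edge $\{v,w\}$ is replaced by $\{v.p, w.p\}$. A vertex is ongoing if it is a root but not the only root among the vertices of its connected component in $G$; otherwise it is finished. -}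

module Defs where

open import Data.Nat using (ℕ)
open import Data.Fin using (Fin)
open import Data.Fin.Properties using (_≟_)
open import Data.Bool using (Bool; true; false; not; _∧_; if_then_else_)
open import Data.List using (List; []; _∷_; length; map; concatMap)
import Data.List as L
open import Data.Vec using (Vec) renaming (lookup to vlookup)
open import Data.Product using (_×_; _,_; ∃)
open import Data.Sum using (_⊎_)
open import Data.List.Membership.Propositional using (_∈_)
open import Relation.Nullary using (¬_)
open import Relation.Nullary.Decidable using (⌊_⌋)
open import Relation.Binary.PropositionalEquality using (_≡_)

-- An undirected (multi)graph on vertex set Fin n: a list of edges {v,w}.
Graph : ℕ → Set
Graph n = List (Fin n × Fin n)

Adjacent : ∀ {n} → Graph n → Fin n → Fin n → Set
Adjacent G v w = ((v , w) ∈ G) ⊎ ((w , v) ∈ G)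

data Connected {n} (G : Graph n) : Fin n → Fin n → Set where
  here : ∀ {v} → Connected G v v
  step : ∀ {v w x} → Adjacent G v w → Connected G w x → Connected G v x

record State (n : ℕ) : Set where
  constructor st
  field
    parent : Fin n → Fin n
    edges  : List (Fin n × Fin n)
open State public

-- The outcome of random-vote in one phase: l v = true means v.l = 1.
Votes : ℕ → Set
Votes n = Vec Bool n

arcs : ∀ {n} → List (Fin n × Fin n) → List (Fin n × Fin n)
arcs = concatMap (λ { (v , w) → (v , w) ∷ (w , v) ∷ [] })

-- the values w written into v.p during link: arcs (v,w) with v.l = 0, w.l = 1
candidates : ∀ {n} → Votes n → List (Fin n × Fin n) → Fin n → List (Fin n)
candidates l E v =
  concatMap (λ { (a , b) → if ⌊ a ≟ v ⌋ ∧ not (vlookup l a) ∧ vlookup l b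
                           then b ∷ [] else [] }) (arcs E)

-- Arbitrary resolution of concurrent writes (an adversary): given the whole
-- history of votes (most recent phase first, including the current one), the
-- vertex v and the nonempty list x ∷ xs of written values, it selects one of them.
Resolver : ℕ → Set
Resolver n = List (Votes n) → (v : Fin n) → (x : Fin n) → (xs : List (Fin n))
             → Fin (ℕ.suc (length xs))

link : ∀ {n} → Resolver n → List (Votes n) → Votes n → State n → Fin n → Fin n
link R h l s v with candidates l (edges s) v
... | []     = parent s v
... | x ∷ xs = L.lookup (x ∷ xs) (R h v x xs)

-- One phase (link, shortcut, alter) given the votes l and history h.
phase : ∀ {n} → Resolver n → List (Votes n) → Votes n → State n → State n
phase R h l s = st p₂ (map (λ { (v , w) → (p₂ v , p₂ w) }) (edges s))
  where
  p₁ : _ → _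
  p₁ = link R h l s
  p₂ : _ → _
  p₂ u = p₁ (p₁ u)

initial : ∀ {n} → Graph n → State n
initial G = st (λ v → v) G

-- run the remaining phases (votes in chronological order); 'past' = history, most recent first
runFrom : ∀ {n} → Resolver n → State n → List (Votes n) → List (Votes n) → State n
runFrom R s past []       = s
runFrom R s past (l ∷ ls) = runFrom R (phase R (l ∷ past) l s) (l ∷ past) ls

run : ∀ {n} → Resolver n → Graph n → List (Votes n) → State n
run R G ls = runFrom R (initial G) [] ls

IsRoot : ∀ {n} → State n → Fin n → Set
IsRoot s v = parent s v ≡ v

Ongoing : ∀ {n} → Graph n → State n → Fin n → Set
Ongoing G s u = IsRoot s u × ∃ λ w → ¬ (w ≡ u) × Connected G u w × IsRoot s w

module Submission where

-- Probabilities are counted on the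
-- uniform space of vote vectors: Pr[E] ≤ a/d means that every list of distinct
-- outcomes in E has length ℓ with ℓ·d ≤ a ('Bound E a d' below).
--
-- By induction on coordinates
-- a random bit vector matches a fixed pattern "r u = β, r w = γ" (u ≠ w) with
-- probability 1/4, i.e. avoids it with probability ≤ 3/4.
--
-- Reachable states satisfy an invariant: trees have depth ≤ 1,
-- current edges join roots, and each edge {a,b} of G is present as {a.p, b.p}.
-- Under it a phase never creates roots, an ongoing root u has a current edge
-- to some z ≠ u, and if u votes 0 while z votes 1 then u hooks and stops being
-- a root.  So one phase keeps u ongoing with probability ≤ 3/4 whatever the
-- history, and conditioning on the first phase gives (3/4)^k by induction.

open import Defs
open import Data.Nat using (ℕ; zero; suc; _+_; _*_; _^_; _≤_; z≤n; s≤s)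
open import Data.Nat.Properties
  using (≤-refl; ≤-trans; ≤-reflexive; +-mono-≤; +-monoʳ-≤; *-monoˡ-≤; *-distribʳ-+;
         +-identityʳ; +-comm; +-suc; *-comm; *-suc; ^-distribˡ-+-*; m≤n+m; m≤m+n; m^n>0; module ≤-Reasoning)
open import Data.Nat.Tactic.RingSolver using (solve-∀)
open import Data.Fin using (Fin; zero; suc)
open import Data.Fin.Properties using () renaming (_≟_ to _≟ᶠ_)
open import Data.Bool using (Bool; true; false; not; _∧_; if_then_else_)
open import Data.Bool.Properties using () renaming (_≟_ to _≟ᵇ_)
open import Data.Vec using (Vec; []; _∷_; head; toList) renaming (lookup to vlookup)
open import Data.Vec.Properties using (≡-dec)
open import Data.List using (List; []; _∷_; length; map)
open import Data.Nat.ListAction using (sum)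
open import Data.List.Relation.Unary.All as All using (All; []; _∷_)
open import Data.List.Relation.Unary.All.Properties using (++⁺; map⁺)
open import Data.List.Relation.Unary.AllPairs using ([]; _∷_)
open import Data.List.Relation.Unary.Any using (here; there)
open import Data.List.Relation.Unary.Unique.Propositional using (Unique)
open import Data.List.Membership.Propositional using (_∈_)
open import Data.List.Membership.Propositional.Properties using (∈-lookup; ∈-++⁺ˡ; ∈-++⁺ʳ; ∈-map⁺)
open import Data.Product using (Σ; _×_; _,_; proj₁; proj₂)
open import Data.Sum using (_⊎_; inj₁; inj₂)
open import Data.Empty using (⊥-elim)
open import Function using (id)
open import Relation.Nullary using (¬_; yes; no)
open import Relation.Nullary.Decidable using (⌊_⌋)
open import Relation.Binary.Definitions using (DecidableEquality)
open import Relation.Binary.PropositionalEquality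
  using (_≡_; _≢_; refl; sym; trans; cong; subst; subst₂; module ≡-Reasoning)

-- Pr[P] ≤ a/d on a finite uniform space A: distinct witnesses of P number at most a/d.
Bound : {A : Set} → (A → Set) → ℕ → ℕ → Set
Bound {A} P a d = (Ω : List A) → Unique Ω → All P Ω → length Ω * d ≤ a

*-swap : ∀ x y z → x * (y * z) ≡ x * z * y
*-swap = solve-∀

*-right-swap : ∀ x y z → x * y * z ≡ x * z * y
*-right-swap = solve-∀

bound-mono : ∀ {A} {P P′ : A → Set} {a a′ d} →
             (∀ {x} → P′ x → P x) → a ≤ a′ → Bound P a d → Bound P′ a′ d
bound-mono P′⇒P a≤a′ bound Ω distinct ps = ≤-trans (bound Ω distinct (All.map P′⇒P ps)) a≤a′

bound-scale : ∀ {A} {P : A → Set} {a d} c → Bound P a d → Bound P (c * a) (c * d)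
bound-scale {a = a} {d} c bound Ω distinct ps = begin
  length Ω * (c * d) ≡⟨ *-swap (length Ω) c d ⟩
  length Ω * d * c   ≤⟨ *-monoˡ-≤ c (bound Ω distinct ps) ⟩
  a * c              ≡⟨ *-comm a c ⟩
  c * a              ∎
  where open ≤-Reasoning

bound-empty : ∀ {A} {P : A → Set} {d} → (∀ {x} → ¬ P x) → Bound P 0 d
bound-empty impossible []      _ _        = z≤n
bound-empty impossible (_ ∷ _) _ (p ∷ _) = ⊥-elim (impossible p)

bound-inhabited : ∀ {A} {P : A → Set} {a d} → (∀ {x} → P x → Bound P a d) → Bound P a d
bound-inhabited bound []      _        _          = z≤n
bound-inhabited bound (x ∷ Ω) distinct (p ∷ ps) = bound p (x ∷ Ω) distinct (p ∷ ps)

bound-nil : ∀ {A : Set} {P : Vec A 0 → Set} → Bound P 1 1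
bound-nil []                 _                  _ = z≤n
bound-nil ([] ∷ [])          _                  _ = s≤s z≤n
bound-nil ([] ∷ [] ∷ _) (([]≢[] ∷ _) ∷ _) _ = ⊥-elim ([]≢[] refl)

module ByHead {A : Set} (_≟_ : DecidableEquality A) {k : ℕ} where

  fiber : A → List (Vec A (suc k)) → List (Vec A k)
  fiber h [] = []
  fiber h ((a ∷ t) ∷ Ω) with a ≟ h
  ... | yes _ = t ∷ fiber h Ω
  ... | no  _ = fiber h Ω

  others : A → List (Vec A (suc k)) → List (Vec A (suc k))
  others h [] = []
  others h ((a ∷ t) ∷ Ω) with a ≟ h
  ... | yes _ = others h Ω
  ... | no  _ = (a ∷ t) ∷ others h Ω

  length-split : ∀ h Ω → length Ω ≡ length (fiber h Ω) + length (others h Ω)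
  length-split h [] = refl
  length-split h ((a ∷ t) ∷ Ω) with a ≟ h
  ... | yes _ = cong suc (length-split h Ω)
  ... | no  _ = trans (cong suc (length-split h Ω)) (sym (+-suc _ _))

  fiber-All : ∀ {P : Vec A (suc k) → Set} h Ω → All P Ω → All (λ t → P (h ∷ t)) (fiber h Ω)
  fiber-All h [] [] = []
  fiber-All h ((a ∷ t) ∷ Ω) (p ∷ ps) with a ≟ h
  ... | yes refl = p ∷ fiber-All h Ω ps
  ... | no  _    = fiber-All h Ω ps

  others-All : ∀ {P : Vec A (suc k) → Set} h Ω → All P Ω → All P (others h Ω)
  others-All h [] [] = []
  others-All h ((a ∷ t) ∷ Ω) (p ∷ ps) with a ≟ h
  ... | yes _ = others-All h Ω ps
  ... | no  _ = p ∷ others-All h Ω ps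

  others-avoid : ∀ h Ω → All (λ x → h ≢ head x) (others h Ω)
  others-avoid h [] = []
  others-avoid h ((a ∷ t) ∷ Ω) with a ≟ h
  ... | yes _   = others-avoid h Ω
  ... | no  a≢h = (λ h≡a → a≢h (sym h≡a)) ∷ others-avoid h Ω

  fiber-Unique : ∀ h Ω → Unique Ω → Unique (fiber h Ω)
  fiber-Unique h [] _ = []
  fiber-Unique h ((a ∷ t) ∷ Ω) (fresh ∷ distinct) with a ≟ h
  ... | yes refl = All.map (λ ≢ht t≡t′ → ≢ht (cong (h ∷_) t≡t′)) (fiber-All h Ω fresh)
                   ∷ fiber-Unique h Ω distinct
  ... | no  _    = fiber-Unique h Ω distinct

  others-Unique : ∀ h Ω → Unique Ω → Unique (others h Ω)
  others-Unique h [] _ = []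
  others-Unique h ((a ∷ t) ∷ Ω) (fresh ∷ distinct) with a ≟ h
  ... | yes _ = others-Unique h Ω distinct
  ... | no  _ = others-All h Ω fresh ∷ others-Unique h Ω distinct

  record HeadCover (b : A → ℕ) (e : ℕ) (Ω : List (Vec A (suc k))) : Set₁ where
    field
      heads    : List A
      unique   : Unique heads
      occur    : ∀ {S : A → Set} → All (λ x → S (head x)) Ω → All S heads
      weight   : length Ω * e ≤ sum (map b heads)

  -- If every fibre {t | P (h ∷ t)} has Pr ≤ b h / e, then every list of distinct
  -- witnesses of P has a head cover: group it into fibres, one head per fibre.
  -- The recursion is on a fuel bound for |Ω|, as 'others h Ω' is not a subterm.
  headCoverWithin : ∀ {P : Vec A (suc k) → Set} {b : A → ℕ} {e} →
              (∀ h → Bound (λ t → P (h ∷ t)) (b h) e) →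
              ∀ fuel Ω → length Ω ≤ fuel → Unique Ω → All P Ω → HeadCover b e Ω
  headCoverWithin _ _ [] _ _ _ = record { heads = [] ; unique = [] ; occur = λ _ → [] ; weight = z≤n }
  headCoverWithin {P} {b} {e} fibreBound (suc fuel) ((h ∷ t) ∷ Ω) (s≤s |Ω|≤fuel) (fresh ∷ distinct) (p ∷ ps) =
    record
      { heads    = h ∷ heads rest
      ; unique   = occur rest (others-avoid h Ω) ∷ unique rest
      ; occur    = λ { (s ∷ ss) → s ∷ occur rest (others-All h Ω ss) }
      ; weight   = begin
          suc (length Ω) * e                         ≡⟨ cong (λ ℓ → suc ℓ * e) (length-split h Ω) ⟩
          (length fib + length (others h Ω)) * e     ≡⟨ *-distribʳ-+ e (length fib) _ ⟩
          length fib * e + length (others h Ω) * e   ≤⟨ +-mono-≤ (fibreBound h fib fib-distinct fib-P) (weight rest) ⟩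
          b h + sum (map b (heads rest))             ∎
      }
    where
    open HeadCover
    open ≤-Reasoning
    fib : List (Vec A k)
    fib = t ∷ fiber h Ω
    fib-distinct : Unique fib
    fib-distinct = All.map (λ ≢ht t≡t′ → ≢ht (cong (h ∷_) t≡t′)) (fiber-All h Ω fresh) ∷ fiber-Unique h Ω distinct
    fib-P : All (λ t → P (h ∷ t)) fib
    fib-P = p ∷ fiber-All h Ω ps
    rest : HeadCover b e (others h Ω)
    rest = headCoverWithin fibreBound fuel (others h Ω)
             (≤-trans (≤-trans (m≤n+m _ (length (fiber h Ω))) (≤-reflexive (sym (length-split h Ω)))) |Ω|≤fuel)
             (others-Unique h Ω distinct) (others-All h Ω ps)

  headCover : ∀ {P : Vec A (suc k) → Set} {b : A → ℕ} {e} →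
              (∀ h → Bound (λ t → P (h ∷ t)) (b h) e) →
              ∀ Ω → Unique Ω → All P Ω → HeadCover b e Ω
  headCover fibreBound Ω = headCoverWithin fibreBound (length Ω) Ω ≤-refl

sum-const : ∀ {A : Set} b (H : List A) → sum (map (λ _ → b) H) ≡ length H * b
sum-const b []      = refl
sum-const b (_ ∷ H) = cong (b +_) (sum-const b H)

bound-cons : ∀ {A} → DecidableEquality A → ∀ {k} {P : Vec A (suc k) → Set} {Q : A → Set} {a b d e} →
             (∀ {h t} → P (h ∷ t) → Q h) → Bound Q a d → (∀ h → Bound (λ t → P (h ∷ t)) b e) →
             Bound P (a * b) (d * e)
bound-cons _≟_ {Q = Q} {a} {b} {d} {e} P⇒Q boundQ fibreBound Ω distinct ps = begin
  length Ω * (d * e)         ≡⟨ *-swap (length Ω) d e ⟩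
  length Ω * e * d           ≤⟨ *-monoˡ-≤ d (weight cover) ⟩
  sum (map (λ _ → b) H) * d  ≡⟨ cong (_* d) (sum-const b H) ⟩
  length H * b * d           ≡⟨ *-right-swap (length H) b d ⟩
  length H * d * b           ≤⟨ *-monoˡ-≤ b (boundQ H (unique cover) heads-Q) ⟩
  a * b                      ∎
  where
  open ByHead _≟_
  open HeadCover
  open ≤-Reasoning
  cover : HeadCover (λ _ → b) e Ω
  cover = headCover fibreBound Ω distinct ps
  H : List _
  H = heads cover
  heads-Q : All Q H
  heads-Q = occur cover (All.map (λ { {_ ∷ _} p → P⇒Q p }) ps)

sum-distinct-Bool : ∀ (β : Bool → ℕ) {H} → Unique H → sum (map β H) ≤ β true + β false
sum-distinct-Bool β {[]}                  _ = z≤n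
sum-distinct-Bool β {true ∷ []}           _ = +-monoʳ-≤ (β true) z≤n
sum-distinct-Bool β {false ∷ []}          _ = ≤-trans (≤-reflexive (+-identityʳ _)) (m≤n+m _ _)
sum-distinct-Bool β {true ∷ true ∷ _}     ((t≢t ∷ _) ∷ _) = ⊥-elim (t≢t refl)
sum-distinct-Bool β {false ∷ false ∷ _}   ((f≢f ∷ _) ∷ _) = ⊥-elim (f≢f refl)
sum-distinct-Bool β {true ∷ false ∷ []}   _ = ≤-reflexive (cong (β true +_) (+-identityʳ _))
sum-distinct-Bool β {false ∷ true ∷ []}   _ =
  ≤-reflexive (trans (cong (β false +_) (+-identityʳ _)) (+-comm (β false) (β true)))
sum-distinct-Bool β {true ∷ false ∷ z ∷ _}  ((_ ∷ t≢z ∷ _) ∷ (f≢z ∷ _) ∷ _) with z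
... | true  = ⊥-elim (t≢z refl)
... | false = ⊥-elim (f≢z refl)
sum-distinct-Bool β {false ∷ true ∷ z ∷ _}  ((_ ∷ f≢z ∷ _) ∷ (t≢z ∷ _) ∷ _) with z
... | true  = ⊥-elim (t≢z refl)
... | false = ⊥-elim (f≢z refl)

bound-bit : ∀ {m} {P : Vec Bool (suc m) → Set} {a b d} (c : Bool) →
            Bound (λ t → P (c ∷ t)) a d → Bound (λ t → P (not c ∷ t)) b d → Bound P (a + b) d
bound-bit {a = a} {b} {d} true  boundT boundF Ω distinct ps =
  ≤-trans (weight cover) (sum-distinct-Bool β (unique cover))
  where
  open ByHead _≟ᵇ_
  open HeadCover
  β : Bool → ℕ
  β true  = a
  β false = b
  cover : HeadCover β d Ω
  cover = headCover (λ { true → boundT ; false → boundF }) Ω distinct ps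
bound-bit {a = a} {b} false boundF boundT Ω distinct ps =
  ≤-trans (bound-bit true boundT boundF Ω distinct ps) (≤-reflexive (+-comm b a))

double : ∀ x → x + x ≡ 2 * x
double = solve-∀

count-all : ∀ m {P : Vec Bool m → Set} → Bound P (2 ^ m) 1
count-all zero    = bound-nil
count-all (suc m) = bound-mono id (≤-reflexive (double (2 ^ m))) (bound-bit true (count-all m) (count-all m))

count-avoid-one : ∀ m (w : Fin m) (γ : Bool) → Bound (λ r → vlookup r w ≢ γ) (2 ^ m) 2
count-avoid-one (suc m) zero    γ = bound-bit γ (bound-empty (λ γ≢γ → γ≢γ refl)) (bound-scale 2 (count-all m))
count-avoid-one (suc m) (suc w) γ =
  bound-mono id (≤-reflexive (double (2 ^ m))) (bound-bit true (count-avoid-one m w γ) (count-avoid-one m w γ))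

Avoid : ∀ {m} → Fin m → Bool → Fin m → Bool → Vec Bool m → Set
Avoid u β w γ r = ¬ (vlookup r u ≡ β × vlookup r w ≡ γ)

-- The two halves of the count for a pattern on the first bit: 1/2·(1/2) + 1/2·1 = 3/4.
quarter+half : ∀ x → 2 * x + 4 * x ≡ 3 * (2 * x)
quarter+half = solve-∀

count-avoid-two : ∀ m (u w : Fin m) → u ≢ w → (β γ : Bool) → Bound (Avoid u β w γ) (3 * 2 ^ m) 4
count-avoid-two (suc m) zero    zero    u≢w β γ = ⊥-elim (u≢w refl)
count-avoid-two (suc m) zero    (suc w) u≢w β γ =
  bound-mono id (≤-reflexive (quarter+half (2 ^ m)))
    (bound-bit β (bound-scale 2 (bound-mono (λ avoid w≡γ → avoid (refl , w≡γ)) ≤-refl (count-avoid-one m w γ)))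
                 (bound-scale 4 (count-all m)))
count-avoid-two (suc m) (suc u) zero    u≢w β γ =
  bound-mono id (≤-reflexive (quarter+half (2 ^ m)))
    (bound-bit γ (bound-scale 2 (bound-mono (λ avoid u≡β → avoid (u≡β , refl)) ≤-refl (count-avoid-one m u β)))
                 (bound-scale 4 (count-all m)))
count-avoid-two (suc m) (suc u) (suc w) u≢w β γ =
  bound-mono id (≤-reflexive (double-three (2 ^ m))) (bound-bit true recurse recurse)
  where
  recurse : Bound (Avoid u β w γ) (3 * 2 ^ m) 4
  recurse = count-avoid-two m u w (λ u≡w → u≢w (cong suc u≡w)) β γ
  double-three : ∀ x → 3 * x + 3 * x ≡ 3 * (2 * x)
  double-three = solve-∀

true≢false : true ≢ false
true≢false ()

written : ∀ {n} → Votes n → Fin n → Fin n → Fin n → List (Fin n)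
written l v a b = if ⌊ a ≟ᶠ v ⌋ ∧ not (vlookup l a) ∧ vlookup l b then b ∷ [] else []

record Hook {n} (s : State n) (l : Votes n) (v w : Fin n) : Set where
  field
    sourceRoot : IsRoot s v
    sourceVote : vlookup l v ≡ false
    targetRoot : IsRoot s w
    targetVote : vlookup l w ≡ true

RootEdge : ∀ {n} → State n → Fin n × Fin n → Set
RootEdge s (a , b) = IsRoot s a × IsRoot s b

written-Hook : ∀ {n} (s : State n) l v a b → IsRoot s a → IsRoot s b → All (Hook s l v) (written l v a b)
written-Hook s l v a b ra rb with a ≟ᶠ v
... | no  _    = []
... | yes refl with vlookup l a in la | vlookup l b in lb
...   | false | true  = record { sourceRoot = ra ; sourceVote = la ; targetRoot = rb ; targetVote = lb } ∷ []
...   | false | false = []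
...   | true  | _     = []

candidates-Hook : ∀ {n} (s : State n) l v E → All (RootEdge s) E → All (Hook s l v) (candidates l E v)
candidates-Hook s l v []            []               = []
candidates-Hook s l v ((a , b) ∷ E) ((ra , rb) ∷ rs) =
  ++⁺ (written-Hook s l v a b ra rb) (++⁺ (written-Hook s l v b a rb ra) (candidates-Hook s l v E rs))

written-self : ∀ {n} (l : Votes n) v z → vlookup l v ≡ false → vlookup l z ≡ true → z ∈ written l v v z
written-self l v z lv lz with v ≟ᶠ v
... | no  v≢v = ⊥-elim (v≢v refl)
... | yes _ rewrite lv | lz = here refl

candidates-complete : ∀ {n} (l : Votes n) v z E → Adjacent E v z →
                      vlookup l v ≡ false → vlookup l z ≡ true → z ∈ candidates l E v
candidates-complete l v z (_ ∷ _) (inj₁ (here refl)) lv lz = ∈-++⁺ˡ (written-self l v z lv lz)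
candidates-complete l v z (_ ∷ _) (inj₂ (here refl)) lv lz = ∈-++⁺ʳ (written l v z v) (∈-++⁺ˡ (written-self l v z lv lz))
candidates-complete l v z ((a , b) ∷ E) (inj₁ (there e)) lv lz =
  ∈-++⁺ʳ (written l v a b) (∈-++⁺ʳ (written l v b a) (candidates-complete l v z E (inj₁ e) lv lz))
candidates-complete l v z ((a , b) ∷ E) (inj₂ (there e)) lv lz =
  ∈-++⁺ʳ (written l v a b) (∈-++⁺ʳ (written l v b a) (candidates-complete l v z E (inj₂ e) lv lz))

link-cases : ∀ {n} (R : Resolver n) h l s v →
             (candidates l (edges s) v ≡ [] × link R h l s v ≡ parent s v) ⊎
             (link R h l s v ∈ candidates l (edges s) v)
link-cases R h l s v with candidates l (edges s) v
... | []     = inj₁ (refl , refl)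
... | x ∷ xs = inj₂ (∈-lookup (R h v x xs))

module Vanilla {n : ℕ} (G : Graph n) (R : Resolver n) where

  record Invariant (s : State n) : Set where
    field
      shallow   : ∀ v → parent s (parent s v) ≡ parent s v
      rootEdges : All (RootEdge s) (edges s)
      tracks    : ∀ {a b} → (a , b) ∈ G → (parent s a , parent s b) ∈ edges s

  initial-invariant : Invariant (initial G)
  initial-invariant = record
    { shallow = λ _ → refl ; rootEdges = All.tabulate (λ _ → refl , refl) ; tracks = id }

  module Phase (past : List (Votes n)) (l : Votes n) (s : State n) (inv : Invariant s) where
    open Invariant inv

    s′ : State n
    s′ = phase R (l ∷ past) l s

    hook : Fin n → Fin n
    hook = link R (l ∷ past) l s

    hook-written : ∀ v → hook v ∈ candidates l (edges s) v → Hook s l v (hook v)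
    hook-written v = All.lookup (candidates-Hook s l v (edges s) rootEdges)

    hook-nonroot : ∀ v → ¬ IsRoot s v → hook v ≡ parent s v
    hook-nonroot v nonroot with link-cases R (l ∷ past) l s v
    ... | inj₁ (_ , unchanged) = unchanged
    ... | inj₂ w              = ⊥-elim (nonroot (Hook.sourceRoot (hook-written v w)))

    hook-stay : ∀ x → IsRoot s x → vlookup l x ≡ true → hook x ≡ x
    hook-stay x root vote with link-cases R (l ∷ past) l s x
    ... | inj₁ (_ , unchanged) = trans unchanged root
    ... | inj₂ w              = ⊥-elim (true≢false (trans (sym vote) (Hook.sourceVote (hook-written x w))))

    hook-root : ∀ x → IsRoot s (hook x)
    hook-root x with link-cases R (l ∷ past) l s x
    ... | inj₁ (_ , unchanged) rewrite unchanged = shallow x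
    ... | inj₂ w              = Hook.targetRoot (hook-written x w)

    hook-twice-root : ∀ r → IsRoot s r → hook (hook r) ≡ hook r
    hook-twice-root r root with link-cases R (l ∷ past) l s r
    ... | inj₁ (_ , unchanged) = cong hook (trans unchanged root)
    ... | inj₂ w               = hook-stay (hook r) (Hook.targetRoot h) (Hook.targetVote h)
      where h = hook-written r w

    shortcut : ∀ v → parent s′ v ≡ hook (parent s v)
    shortcut v with parent s v ≟ᶠ v
    ... | yes root    = trans (hook-twice-root v root) (cong hook (sym root))
    ... | no  nonroot = cong hook (hook-nonroot v nonroot)

    -- Hence a G-edge {a, b}, present as {a.p, b.p}, becomes {a.p′, b.p′} after alter.
    shortcut-parent : ∀ a → parent s′ (parent s a) ≡ parent s′ a
    shortcut-parent a = trans (shortcut (parent s a)) (trans (cong hook (shallow a)) (sym (shortcut a)))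

    shallow′ : ∀ v → parent s′ (parent s′ v) ≡ parent s′ v
    shallow′ v = begin
      hook (hook (hook (hook v))) ≡⟨ cong (λ x → hook (hook x)) (shortcut v) ⟩
      hook (hook (hook r))        ≡⟨ shortcut (hook r) ⟩
      hook (parent s (hook r))    ≡⟨ cong hook (hook-root r) ⟩
      hook (hook r)               ≡⟨ hook-twice-root r (shallow v) ⟩
      hook r                      ≡⟨ sym (shortcut v) ⟩
      hook (hook v)               ∎
      where
      open ≡-Reasoning
      r = parent s v

    invariant′ : Invariant s′
    invariant′ = record
      { shallow   = shallow′
      ; rootEdges = map⁺ (All.tabulate (λ {e} _ → shallow′ (proj₁ e) , shallow′ (proj₂ e)))
      ; tracks    = λ {a} {b} e → subst₂ (λ x y → (x , y) ∈ edges s′)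
                      (shortcut-parent a) (shortcut-parent b) (∈-map⁺ _ (tracks e))
      }

    root-before : ∀ v → IsRoot s′ v → IsRoot s v
    root-before v root′ = subst (IsRoot s) (trans (sym (shortcut v)) root′) (hook-root (parent s v))

    ongoing-before : ∀ u → Ongoing G s′ u → Ongoing G s u
    ongoing-before u (root , w , w≢u , connected , rootw) =
      root-before u root , w , w≢u , connected , root-before w rootw

    hooked-root-dies : ∀ u z → IsRoot s u → Adjacent (edges s) u z →
                       vlookup l u ≡ false → vlookup l z ≡ true → ¬ IsRoot s′ u
    hooked-root-dies u z root adjacent lu lz root′ with link-cases R (l ∷ past) l s u
    ... | inj₁ (none , _) with () ← subst (z ∈_) none (candidates-complete l u z (edges s) adjacent lu lz)
    ... | inj₂ w = true≢false (trans (sym (Hook.targetVote (hook-written u w))) (trans (cong (vlookup l) stays) lu))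
      where
      stays : hook u ≡ u
      stays = trans (cong hook (sym root)) (trans (sym (shortcut u)) root′)

  boundary-edge : ∀ s → Invariant s → ∀ u {x y} → Connected G x y → parent s x ≡ u → parent s y ≢ u →
                  Σ (Fin n) λ z → z ≢ u × Adjacent (edges s) u z
  boundary-edge s inv u here                px≡u py≢u = ⊥-elim (py≢u px≡u)
  boundary-edge s inv u (step {w = w} adj c) px≡u py≢u with parent s w ≟ᶠ u
  ... | yes pw≡u = boundary-edge s inv u c pw≡u py≢u
  ... | no  pw≢u with adj
  ...   | inj₁ e = parent s w , pw≢u , inj₁ (subst (λ q → (q , parent s w) ∈ edges s) px≡u (Invariant.tracks inv e))
  ...   | inj₂ e = parent s w , pw≢u , inj₂ (subst (λ q → (parent s w , q) ∈ edges s) px≡u (Invariant.tracks inv e))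

  ongoing-edge : ∀ s → Invariant s → ∀ u → Ongoing G s u → Σ (Fin n) λ z → z ≢ u × Adjacent (edges s) u z
  ongoing-edge s inv u (root , w , w≢u , connected , rootw) =
    boundary-edge s inv u connected root (λ pw≡u → w≢u (trans (sym rootw) pw≡u))

  run-ongoing-before : ∀ u s past ls → Invariant s → Ongoing G (runFrom R s past ls) u → Ongoing G s u
  run-ongoing-before u s past []       inv ongoing = ongoing
  run-ongoing-before u s past (l ∷ ls) inv ongoing = Phase.ongoing-before past l s inv u
    (run-ongoing-before u _ (l ∷ past) ls (Phase.invariant′ past l s inv) ongoing)

  -- Whatever the history, u survives one more phase as an ongoing vertex with
  -- probability ≤ 3/4: it survives only if it avoids the votes (0, 1) on u and z.
  phase-bound : ∀ u s past → Invariant s → Bound (λ l → Ongoing G (phase R (l ∷ past) l s) u) (3 * 2 ^ n) 4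
  phase-bound u s past inv = bound-inhabited λ {l₀} ongoing₀ →
    let (root , another-root) = Phase.ongoing-before past l₀ s inv u ongoing₀
        (z , z≢u , adjacent) = ongoing-edge s inv u (root , another-root)
    in bound-mono (λ {l} (root′ , _) (lu , lz) → Phase.hooked-root-dies past l s inv u z root adjacent lu lz root′)
                  ≤-refl (count-avoid-two n u z (λ u≡z → z≢u (sym u≡z)) false true)

  -- The numerator of (3/4)·(3/4)^k.
  cost-step : ∀ x y z → (3 * x) * (y * z) ≡ (3 * y) * (x * z)
  cost-step = solve-∀

  -- (3/4)^k after k phases, by conditioning on the votes of the first phase.
  run-bound : ∀ u k s past → Invariant s →
              Bound (λ (ω : Vec (Votes n) k) → Ongoing G (runFrom R s past (toList ω)) u) (3 ^ k * 2 ^ (n * k)) (4 ^ k)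
  run-bound u zero    s past inv = bound-mono id (≤-trans (m^n>0 2 (n * 0)) (m≤m+n _ 0)) bound-nil
  run-bound u (suc k) s past inv =
    bound-mono id (≤-reflexive exponent)
      (bound-cons (≡-dec _≟ᵇ_) (λ {l} {t} → run-ongoing-before u _ (l ∷ past) (toList t) (Phase.invariant′ past l s inv))
        (phase-bound u s past inv) (λ l → run-bound u k _ (l ∷ past) (Phase.invariant′ past l s inv)))
    where
    exponent : (3 * 2 ^ n) * (3 ^ k * 2 ^ (n * k)) ≡ 3 ^ suc k * 2 ^ (n * suc k)
    exponent = trans (cost-step (2 ^ n) (3 ^ k) (2 ^ (n * k)))
                 (cong (3 ^ suc k *_) (trans (sym (^-distribˡ-+-* 2 n (n * k))) (cong (2 ^_) (sym (*-suc n k)))))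

lemma3p3 : ∀ {n} (G : Graph n) (R : Resolver n) (u : Fin n) (k : ℕ)
           (Ω : List (Vec (Votes n) k)) → Unique Ω
           → All (λ ω → Ongoing G (run R G (toList ω)) u) Ω
           → length Ω * 4 ^ k ≤ 3 ^ k * 2 ^ (n * k)
lemma3p3 G R u k = Vanilla.run-bound G R u k (initial G) [] (Vanilla.initial-invariant G R)
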